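{- Let $p$ be a prime and let $\mathcal{I}$ and $\mathcal{J}$ be subsets of $\mathbb{F}_p^*$, each consisting of $\lfloor\sqrt{8p}\rfloor$ consecutive integers modulo $p$. Then every integer $\lambda$ can be represented in the form $$\frac{m_1}{x_1}+\frac{m_2}{x_2}\equiv \lambda \pmod p,\qquad m_1,m_2\in\mathcal{I},\quad x_1,x_2\in\mathcal{J}.$$
   Context: $\mathbb{F}_p$ is the field of residues modulo $p$, identified with $\{0,1,\ldots,p-1\}$, $\mathbb{F}_p^*=\mathbb{F}_p\setminus\{0\}$. A set of $N$ consecutive integers modulo $p$ means a set $\{L+1,L+2,\ldots,L+N\}$ reduced modulo $p$ for some integer $L$. $m/x$ denotes $m x^{ -1}$ in $\mathbb{F}_p$. -}

module Defs where

open import Data.Nat as ℕ using (ℕ)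
open import Data.Integer using (ℤ; +_; _+_; _-_; _*_)
open import Data.Integer.Divisibility using (_∣_)
open import Data.Product using (Σ; ∃; _×_; _,_)
open import Data.Empty using (⊥)

infix 4 _≡_[mod_]
_≡_[mod_] : ℤ → ℤ → ℕ → Set
a ≡ b [mod p ] = (+ p) ∣ (a - b)

IsFloorSqrt : ℕ → ℕ → Set
IsFloorSqrt n s = (s ℕ.* s ℕ.≤ n) × (n ℕ.< ℕ.suc s ℕ.* ℕ.suc s)

InConsecutive : (p : ℕ) (L : ℤ) (N : ℕ) → ℤ → Set
InConsecutive p L N a = Σ ℕ λ i → (1 ℕ.≤ i) × (i ℕ.≤ N) × (a ≡ L + (+ i) [mod p ])

-- the set {L+1, …, L+N} mod p is contained in 𝔽ₚ* (contains no multiple of p)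
AvoidsZero : (p : ℕ) (L : ℤ) (N : ℕ) → Set
AvoidsZero p L N = ∀ a → InConsecutive p L N a → (a ≡ + 0 [mod p ] → ⊥)

IsInverseMod : ℕ → ℤ → ℤ → Set
IsInverseMod p x y = x * y ≡ + 1 [mod p ]

-- N = ⌊√(8p)⌋ satisfies N² ≥ p, so every residue mod p has a representative a + N b with
-- 0 ≤ a, b < N.  Applied to a suitable residue, this yields x₁ = K + (N − a) and
-- x₂ = K + (1 + b) in 𝒥 with x₁ ≡ N x₂, so that 1/x₂ = N/x₁.  Then
-- m₁/x₁ + m₂/x₂ = (m₁ + N m₂)/x₁, and a second application of the same fact gives
-- m₁, m₂ ∈ ℐ with m₁ + N m₂ ≡ λ x₁.
module Submission where

open import Defs
open import Data.Nat using (ℕ)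
open import Data.Nat.Primality using (Prime)
open import Data.Integer using (ℤ; _+_; _*_)
open import Data.Product using (Σ; _×_)

open import Data.Nat as ℕ using (zero; suc; NonZero)
import Data.Nat.Properties as ℕₚ
open import Data.Nat.DivMod using (_%_; _/_; m≡m%n+[m/n]*n; m%n<n; m<n*o⇒m/o<n)
open import Data.Nat.Primality using (prime⇒nonZero)
open import Data.Nat.Coprimality using (prime⇒coprime; coprime-Bézout)
open import Data.Nat.GCD using (module Bézout)
import Data.Nat.Tactic.RingSolver as ℕ-Solver
open import Data.Integer using (+_; -_; _-_; _⊖_; 0ℤ; 1ℤ)
open import Data.Integer.Properties using (pos-*; *-comm; *-assoc; *-identityʳ; neg-distribˡ-*; ⊖-≥; m-n≡m⊖n)
open import Data.Integer.DivMod using (_%ℕ_; _/ℕ_; n%ℕd<d; a≡a%ℕn+[a/ℕn]*n)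
open import Data.Integer.Divisibility.Signed
  using (∣⇒∣ᵤ; ∣-refl; ∣m⇒∣-m; ∣m∣n⇒∣m+n; ∣m⇒∣m*n; ∣n⇒∣m*n) renaming (_∣_ to _∣ˢ_)
open import Data.Integer.Tactic.RingSolver using (solve-∀)
open import Data.Product using (_,_)
open import Function using (_∘_)
open import Relation.Binary.Bundles using (Setoid)
import Relation.Binary.Reasoning.Setoid as SetoidReasoning
open import Relation.Binary.PropositionalEquality
  using (_≡_; refl; sym; trans; cong; subst; module ≡-Reasoning)
open import Relation.Nullary using (¬_; contradiction)

floorSqrt[8p]⇒p≤N² : ∀ p N → IsFloorSqrt (8 ℕ.* p) N → p ℕ.≤ N ℕ.* N
floorSqrt[8p]⇒p≤N² p zero (_ , 8p<1) = ℕₚ.≤-trans (ℕₚ.m≤n*m p 8) (ℕₚ.≤-pred 8p<1)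
floorSqrt[8p]⇒p≤N² p (suc n) (_ , 8p<[1+N]²) =
  ℕₚ.<⇒≤ (ℕₚ.*-cancelˡ-< 8 p _ (ℕₚ.<-≤-trans 8p<[1+N]² [2+n]²≤8[1+n]²))
  where
  -- the difference is a polynomial in n with nonnegative coefficients
  expand : ∀ n → 8 ℕ.* (suc n ℕ.* suc n)
         ≡ suc (suc n) ℕ.* suc (suc n) ℕ.+ (4 ℕ.+ 12 ℕ.* n ℕ.+ 7 ℕ.* (n ℕ.* n))
  expand = ℕ-Solver.solve-∀
  [2+n]²≤8[1+n]² : suc (suc n) ℕ.* suc (suc n) ℕ.≤ 8 ℕ.* (suc n ℕ.* suc n)
  [2+n]²≤8[1+n]² = subst (suc (suc n) ℕ.* suc (suc n) ℕ.≤_) (sym (expand n)) (ℕₚ.m≤m+n _ _)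

-- Congruence wrapped in a record, so that a and b can be inferred from a proof of
-- a ≋ b [mod p] (the function _≡_[mod_] is not injective in them).
infix 4 _≋_[mod_]
record _≋_[mod_] (a b : ℤ) (p : ℕ) : Set where
  constructor mod-by
  field divides-difference : + p ∣ˢ a - b

open _≋_[mod_]

module _ {p : ℕ} where

  private
    P : ℤ
    P = + p

  ≋⇒≡[mod] : ∀ {a b} → a ≋ b [mod p ] → a ≡ b [mod p ]
  ≋⇒≡[mod] = ∣⇒∣ᵤ ∘ divides-difference

  by-difference : ∀ {a b} c → a - b ≡ c → P ∣ˢ c → a ≋ b [mod p ]
  by-difference c eq p∣c = mod-by (subst (P ∣ˢ_) (sym eq) p∣c)

  by-multiple : ∀ {a b} k → a - b ≡ k * P → a ≋ b [mod p ]
  by-multiple k eq = by-difference (k * P) eq (∣n⇒∣m*n k ∣-refl)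

  ≋-refl : ∀ {a} → a ≋ a [mod p ]
  ≋-refl {a} = by-multiple 0ℤ (difference a P)
    where
    difference : ∀ a P → a - a ≡ 0ℤ * P
    difference = solve-∀

  ≋-sym : ∀ {a b} → a ≋ b [mod p ] → b ≋ a [mod p ]
  ≋-sym {a} {b} (mod-by p∣a-b) = by-difference _ (difference a b) (∣m⇒∣-m p∣a-b)
    where
    difference : ∀ a b → b - a ≡ - (a - b)
    difference = solve-∀

  ≋-trans : ∀ {a b c} → a ≋ b [mod p ] → b ≋ c [mod p ] → a ≋ c [mod p ]
  ≋-trans {a} {b} {c} (mod-by p∣a-b) (mod-by p∣b-c) =
    by-difference _ (difference a b c) (∣m∣n⇒∣m+n p∣a-b p∣b-c)
    where
    difference : ∀ a b c → a - c ≡ (a - b) + (b - c)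
    difference = solve-∀

  +-congʳ-≋ : ∀ {a b} c → a ≋ b [mod p ] → a + c ≋ b + c [mod p ]
  +-congʳ-≋ {a} {b} c (mod-by p∣a-b) = by-difference _ (difference a b c) p∣a-b
    where
    difference : ∀ a b c → (a + c) - (b + c) ≡ a - b
    difference = solve-∀

  *-congʳ-≋ : ∀ {a b} c → a ≋ b [mod p ] → a * c ≋ b * c [mod p ]
  *-congʳ-≋ {a} {b} c (mod-by p∣a-b) = by-difference _ (difference a b c) (∣m⇒∣m*n c p∣a-b)
    where
    difference : ∀ a b c → a * c - b * c ≡ (a - b) * c
    difference = solve-∀

  *-congˡ-≋ : ∀ {a b} c → a ≋ b [mod p ] → c * a ≋ c * b [mod p ]
  *-congˡ-≋ {a} {b} c (mod-by p∣a-b) = by-difference _ (difference a b c) (∣n⇒∣m*n c p∣a-b)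
    where
    difference : ∀ a b c → c * a - c * b ≡ c * (a - b)
    difference = solve-∀

  ≋-setoid : Setoid _ _
  ≋-setoid = record
    { Carrier       = ℤ
    ; _≈_           = _≋_[mod p ]
    ; isEquivalence = record { refl = ≋-refl ; sym = ≋-sym ; trans = ≋-trans }
    }

  +-multiple-≋ : ∀ a k → a + k * P ≋ a [mod p ]
  +-multiple-≋ a k = by-multiple k (difference a k P)
    where
    difference : ∀ a k P → a + k * P - a ≡ k * P
    difference = solve-∀

  ≋-%ℕ : .{{_ : NonZero p}} → ∀ c → c ≋ + (c %ℕ p) [mod p ]
  ≋-%ℕ c = begin
    c                             ≡⟨ a≡a%ℕn+[a/ℕn]*n c p ⟩
    + (c %ℕ p) + (c /ℕ p) * P     ≈⟨ +-multiple-≋ (+ (c %ℕ p)) (c /ℕ p) ⟩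
    + (c %ℕ p)                    ∎
    where open SetoidReasoning ≋-setoid

two-digit-representative : ∀ {p} .{{_ : NonZero p}} M → p ℕ.≤ M ℕ.* M → ∀ c →
  Σ ℕ λ a → Σ ℕ λ b → a ℕ.< M × b ℕ.< M × + a + + M * + b ≋ c [mod p ]
two-digit-representative {p} zero p≤0 c = contradiction (ℕₚ.n≤0⇒n≡0 p≤0) (ℕ.≢-nonZero⁻¹ p)
two-digit-representative {p} M@(suc _) p≤M² c =
  r % M , r / M , m%n<n r M , m<n*o⇒m/o<n (ℕₚ.<-≤-trans (n%ℕd<d c p) p≤M²) , digits≋c
  where
  r : ℕ
  r = c %ℕ p
  open SetoidReasoning ≋-setoid
  digits≋c : + (r % M) + + M * + (r / M) ≋ c [mod p ]
  digits≋c = begin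
    + (r % M) + + M * + (r / M)  ≡⟨ cong (λ z → + (r % M) + z) (sym (pos-* M (r / M))) ⟩
    + (r % M ℕ.+ M ℕ.* (r / M))  ≡⟨ cong (λ n → + (r % M ℕ.+ n)) (ℕₚ.*-comm M (r / M)) ⟩
    + (r % M ℕ.+ r / M ℕ.* M)    ≡⟨ cong +_ (sym (m≡m%n+[m/n]*n r M)) ⟩
    + r                          ≈⟨ ≋-sym (≋-%ℕ c) ⟩
    c                            ∎

Bézout⇒inverse : ∀ {p r} → Bézout.Identity 1 p r → Σ ℤ λ y → + r * y ≋ 1ℤ [mod p ]
Bézout⇒inverse {p} {r} (Bézout.+- x y eq) = - + y , by-multiple (- + x) (begin
  + r * - + y - 1ℤ      ≡⟨ rearrange (+ r) (+ y) ⟩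
  - (1ℤ + + y * + r)    ≡⟨ cong (λ n → - (1ℤ + n)) (sym (pos-* y r)) ⟩
  - + (1 ℕ.+ y ℕ.* r)   ≡⟨ cong (λ n → - + n) eq ⟩
  - + (x ℕ.* p)         ≡⟨ cong -_ (pos-* x p) ⟩
  - (+ x * + p)         ≡⟨ neg-distribˡ-* (+ x) (+ p) ⟩
  - + x * + p           ∎)
  where
  open ≡-Reasoning
  rearrange : ∀ r y → r * - y - 1ℤ ≡ - (1ℤ + y * r)
  rearrange = solve-∀
Bézout⇒inverse {p} {r} (Bézout.-+ x y eq) = + y , by-multiple (+ x) (begin
  + r * + y - 1ℤ        ≡⟨ cong (_- 1ℤ) (trans (*-comm (+ r) (+ y)) (sym (pos-* y r))) ⟩
  + (y ℕ.* r) - 1ℤ      ≡⟨ cong (λ n → + n - 1ℤ) (sym eq) ⟩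
  + (x ℕ.* p)           ≡⟨ pos-* x p ⟩
  + x * + p             ∎)
  where open ≡-Reasoning

inverse-mod-prime : ∀ {p} → Prime p → ∀ x → ¬ (x ≡ 0ℤ [mod p ]) → Σ ℤ λ y → x * y ≋ 1ℤ [mod p ]
inverse-mod-prime {p} p-prime x x≢0 = invert (x %ℕ p) (n%ℕd<d x p) (≋-%ℕ x)
  where
  instance
    p≢0 : NonZero p
    p≢0 = prime⇒nonZero p-prime
  invert : ∀ r → r ℕ.< p → x ≋ + r [mod p ] → Σ ℤ λ y → x * y ≋ 1ℤ [mod p ]
  invert zero _ x≋0 = contradiction (≋⇒≡[mod] x≋0) x≢0
  invert r@(suc _) r<p x≋r with Bézout⇒inverse (coprime-Bézout (prime⇒coprime p-prime r<p))
  ... | y , ry≋1 = y , ≋-trans (*-congʳ-≋ y x≋r) ry≋1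

L+i∈consecutive : ∀ {p N} L i → 1 ℕ.≤ i → i ℕ.≤ N → InConsecutive p L N (L + + i)
L+i∈consecutive L i 1≤i i≤N = i , 1≤i , i≤N , ≋⇒≡[mod] (≋-refl {a = L + + i})

consecutive-pair-x≋M*x′ : ∀ {p} .{{_ : NonZero p}} M → p ℕ.≤ M ℕ.* M → ∀ K →
  Σ ℤ λ x → Σ ℤ λ x′ → InConsecutive p K M x × InConsecutive p K M x′ × x ≋ + M * x′ [mod p ]
consecutive-pair-x≋M*x′ {p} M p≤M² K
  with two-digit-representative M p≤M² (K - + M * K)
... | a , b , a<M , b<M , digits≋c =
  x , x′ ,
  L+i∈consecutive K (M ℕ.∸ a) (ℕₚ.m<n⇒0<n∸m a<M) (ℕₚ.m∸n≤m M a) ,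
  L+i∈consecutive K (suc b) (ℕ.s≤s ℕ.z≤n) b<M ,
  x≋Mx′
  where
  x x′ d : ℤ
  x = K + + (M ℕ.∸ a)
  x′ = K + + suc b
  d = + a + + M * + b
  rearrange : ∀ K M a b → K + (M - a) ≡ (K - M * K) + (M * (K + (1ℤ + b)) - (a + M * b))
  rearrange = solve-∀
  cancel : ∀ d e → d + (e - d) ≡ e
  cancel = solve-∀
  open SetoidReasoning ≋-setoid
  x≋Mx′ : x ≋ + M * x′ [mod p ]
  x≋Mx′ = begin
    K + + (M ℕ.∸ a)              ≡⟨ cong (λ z → K + z) (sym (⊖-≥ (ℕₚ.<⇒≤ a<M))) ⟩
    K + (M ⊖ a)                  ≡⟨ cong (λ z → K + z) (sym (m-n≡m⊖n M a)) ⟩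
    K + (+ M - + a)              ≡⟨ rearrange K (+ M) (+ a) (+ b) ⟩
    (K - + M * K) + (+ M * x′ - d) ≈⟨ +-congʳ-≋ (+ M * x′ - d) (≋-sym digits≋c) ⟩
    d + (+ M * x′ - d)           ≡⟨ cancel d (+ M * x′) ⟩
    + M * x′                     ∎

consecutive-pair-m+M*m′≋ : ∀ {p} .{{_ : NonZero p}} M → p ℕ.≤ M ℕ.* M → ∀ L d →
  Σ ℤ λ m → Σ ℤ λ m′ → InConsecutive p L M m × InConsecutive p L M m′ × m + + M * m′ ≋ d [mod p ]
consecutive-pair-m+M*m′≋ {p} M p≤M² L d
  with two-digit-representative M p≤M² (d - (1ℤ + + M) * (L + 1ℤ))
... | a , b , a<M , b<M , digits≋c =
  m , m′ ,
  L+i∈consecutive L (suc a) (ℕ.s≤s ℕ.z≤n) a<M ,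
  L+i∈consecutive L (suc b) (ℕ.s≤s ℕ.z≤n) b<M ,
  m+Mm′≋d
  where
  m m′ e : ℤ
  m = L + + suc a
  m′ = L + + suc b
  e = (1ℤ + + M) * (L + 1ℤ)
  rearrange : ∀ L M a b → (L + (1ℤ + a)) + M * (L + (1ℤ + b)) ≡ (a + M * b) + (1ℤ + M) * (L + 1ℤ)
  rearrange = solve-∀
  cancel : ∀ d e → (d - e) + e ≡ d
  cancel = solve-∀
  open SetoidReasoning ≋-setoid
  m+Mm′≋d : m + + M * m′ ≋ d [mod p ]
  m+Mm′≋d = begin
    m + + M * m′         ≡⟨ rearrange L (+ M) (+ a) (+ b) ⟩
    (+ a + + M * + b) + e ≈⟨ +-congʳ-≋ e digits≋c ⟩
    (d - e) + e          ≡⟨ cancel d e ⟩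
    d                    ∎

inverse-of-factor : ∀ {p x x′ y} t → x * y ≋ 1ℤ [mod p ] → x ≋ t * x′ [mod p ] →
  x′ * (t * y) ≋ 1ℤ [mod p ]
inverse-of-factor {_} {x} {x′} {y} t xy≋1 x≋tx′ = begin
  x′ * (t * y)   ≡⟨ rearrange x′ t y ⟩
  (t * x′) * y   ≈⟨ *-congʳ-≋ y (≋-sym x≋tx′) ⟩
  x * y          ≈⟨ xy≋1 ⟩
  1ℤ             ∎
  where
  open SetoidReasoning ≋-setoid
  rearrange : ∀ x′ t y → x′ * (t * y) ≡ (t * x′) * y
  rearrange = solve-∀

sum-over-common-denominator : ∀ {p x y λ′} m m′ t → x * y ≋ 1ℤ [mod p ] →
  m + t * m′ ≋ λ′ * x [mod p ] → m * y + m′ * (t * y) ≋ λ′ [mod p ]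
sum-over-common-denominator {_} {x} {y} {λ′} m m′ t xy≋1 m+tm′≋λx = begin
  m * y + m′ * (t * y)  ≡⟨ factor m m′ t y ⟩
  (m + t * m′) * y      ≈⟨ *-congʳ-≋ y m+tm′≋λx ⟩
  λ′ * x * y            ≡⟨ *-assoc λ′ x y ⟩
  λ′ * (x * y)          ≈⟨ *-congˡ-≋ λ′ xy≋1 ⟩
  λ′ * 1ℤ               ≡⟨ *-identityʳ λ′ ⟩
  λ′                    ∎
  where
  open SetoidReasoning ≋-setoid
  factor : ∀ m m′ t y → m * y + m′ * (t * y) ≡ (m + t * m′) * y
  factor = solve-∀

theorem1p3 : (p : ℕ) → Prime p → (N : ℕ) → IsFloorSqrt (8 Data.Nat.* p) N →
    (L K : ℤ) → AvoidsZero p L N → AvoidsZero p K N →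
    (λ′ : ℤ) →
    Σ ℤ λ m₁ → Σ ℤ λ m₂ → Σ ℤ λ x₁ → Σ ℤ λ x₂ → Σ ℤ λ y₁ → Σ ℤ λ y₂ →
      InConsecutive p L N m₁ × InConsecutive p L N m₂ ×
      InConsecutive p K N x₁ × InConsecutive p K N x₂ ×
      IsInverseMod p x₁ y₁ × IsInverseMod p x₂ y₂ ×
      (m₁ * y₁ + m₂ * y₂ ≡ λ′ [mod p ])
-- the hypothesis that ℐ avoids 0 is not needed: only 1/x₁ has to exist
theorem1p3 p p-prime N ⌊√8p⌋≡N L K _ K-avoids-0 λ′ =
  let (x₁ , x₂ , x₁∈𝒥 , x₂∈𝒥 , x₁≋Nx₂) = consecutive-pair-x≋M*x′ N p≤N² K
      (y₁ , x₁y₁≋1) = inverse-mod-prime p-prime x₁ (K-avoids-0 x₁ x₁∈𝒥)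
      (m₁ , m₂ , m₁∈ℐ , m₂∈ℐ , m₁+Nm₂≋λx₁) = consecutive-pair-m+M*m′≋ N p≤N² L (λ′ * x₁)
  in  m₁ , m₂ , x₁ , x₂ , y₁ , + N * y₁ , m₁∈ℐ , m₂∈ℐ , x₁∈𝒥 , x₂∈𝒥 ,
      ≋⇒≡[mod] x₁y₁≋1 ,
      ≋⇒≡[mod] (inverse-of-factor (+ N) x₁y₁≋1 x₁≋Nx₂) ,
      ≋⇒≡[mod] (sum-over-common-denominator m₁ m₂ (+ N) x₁y₁≋1 m₁+Nm₂≋λx₁)
  where
  instance
    p≢0 : NonZero p
    p≢0 = prime⇒nonZero p-prime
  p≤N² : p ℕ.≤ N ℕ.* N
  p≤N² = floorSqrt[8p]⇒p≤N² p N ⌊√8p⌋≡N
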